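{- Let $n\ge3$ and let $G$ be the leafed $n$-cycle: the cycle on vertices $0,1,\ldots,n-1$ (labeled cyclically) together with an extra vertex $n$ adjacent only to vertex $0$. Let $L_n$ be the Laplacian of $G$ with the row and column of vertex $n$ deleted (indices $0,\ldots,n-1$). Let $\mathcal{C}_n=\{\lambda\in\mathbb{R}^n: L_n\lambda\ge0\}$ and $\sigma_{\mathcal{C}_n}(q)=\sum_{\lambda\in\mathcal{C}_n\cap\mathbb{Z}^n}q^{\lambda_0}$. Let $S_n$ be the set of vectors $c=(c_0,\ldots,c_{n-1})$ with $c_j\in\{0,1,\ldots,n-1\}$ satisfying $0\cdot c_0+\sum_{j=1}^{n-1}(n-j)c_j\equiv0\pmod n$, and for $c\in S_n$ put $\phi(c)=\sum_{j=0}^{n-1}c_j$. Then \[\sigma_{\mathcal{C}_n}(q)=\frac{\sum_{c\in S_n}q^{\phi(c)}}{(1-q^n)^n}.\]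
   Context: The Laplacian of a simple graph is $L=D-A$ with $D$ the diagonal degree matrix and $A$ the $0/1$ adjacency matrix. Explicitly, $L_n$ has $(0,0)$ entry $3$, diagonal entries $2$ otherwise, entries $-1$ in positions $(i,j)$ with $i,j$ adjacent on the cycle, and $0$ elsewhere. -}

module Defs where

open import Data.Bool using (Bool; true; false; if_then_else_; _∨_; _∧_)
open import Data.Nat as ℕ using (ℕ; zero; suc; _≡ᵇ_; _∸_)
open import Data.Nat.Divisibility using (_∣_; _∣?_)
open import Data.Nat.ListAction using (sum)
open import Data.Integer as ℤ using (ℤ; +_; _≤_)
open import Data.Fin using (Fin; toℕ)
open import Data.List as List using (List; []; _∷_; allFin; upTo; length; filter; map; concatMap)
open import Data.List.Membership.Propositional using (_∈_)
open import Data.List.Relation.Unary.Unique.Propositional using (Unique)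
open import Data.Vec as Vec using (Vec; lookup)
open import Data.Product using (Σ; _×_; _,_)
open import Function.Bundles using (_⇔_)
open import Relation.Binary.PropositionalEquality using (_≡_)
open import Relation.Nullary.Decidable using (_×-dec_)

sumFin : (n : ℕ) → (Fin n → ℤ) → ℤ
sumFin n f = List.foldr ℤ._+_ (+ 0) (List.map f (allFin n))

cycleAdj : (n : ℕ) → Fin n → Fin n → Bool
cycleAdj n i j =
  (toℕ j ≡ᵇ suc (toℕ i)) ∨ (toℕ i ≡ᵇ suc (toℕ j))
  ∨ ((toℕ i ≡ᵇ 0) ∧ (toℕ j ≡ᵇ (n ∸ 1)))
  ∨ ((toℕ j ≡ᵇ 0) ∧ (toℕ i ≡ᵇ (n ∸ 1)))

-- L_n: Laplacian of the leafed n-cycle (leaf n attached to 0) with the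
-- row/column of vertex n deleted.
Lmat : (n : ℕ) → Fin n → Fin n → ℤ
Lmat n i j =
  if toℕ i ≡ᵇ toℕ j
  then (if toℕ i ≡ᵇ 0 then + 3 else + 2)
  else (if cycleAdj n i j then ℤ.-[1+ 0 ] else + 0)

Lapply : (n : ℕ) → Vec ℤ n → Fin n → ℤ
Lapply n v i = sumFin n (λ j → Lmat n i j ℤ.* lookup v j)

InCone : (n : ℕ) → Vec ℤ n → Set
InCone n v = (i : Fin n) → + 0 ≤ Lapply n v i

-- "P has exactly m elements": an explicit duplicate-free enumeration of length m
HasCard : {A : Set} → (A → Set) → ℕ → Set
HasCard {A} P m =
  Σ (List A) λ xs → Unique xs × ((x : A) → (x ∈ xs ⇔ P x)) × length xs ≡ m

allVecs : (n m : ℕ) → List (Vec (Fin n) m)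
allVecs n zero = Vec.[] ∷ []
allVecs n (suc m) = concatMap (λ x → map (x Vec.∷_) (allVecs n m)) (allFin n)

weight : (n : ℕ) → Vec (Fin n) n → ℕ
weight n c = sum (map (λ j → if toℕ j ≡ᵇ 0 then 0 else (n ∸ toℕ j) ℕ.* toℕ (lookup c j)) (allFin n))

phi : (n : ℕ) → Vec (Fin n) n → ℕ
phi n c = sum (map (λ j → toℕ (lookup c j)) (allFin n))

-- coefficient of q^k in Σ_{c ∈ S_n} q^{φ(c)}
numCoeff : (n : ℕ) → ℕ → ℕ
numCoeff n k = length (filter (λ c → (n ∣? weight n c) ×-dec (phi n c ℕ.≟ k)) (allVecs n n))

-- formal power series over ℤ, as coefficient sequences
Series : Set
Series = ℕ → ℤ

_⊛_ : Series → Series → Series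
(f ⊛ g) k = List.foldr ℤ._+_ (+ 0) (map (λ i → f i ℤ.* g (k ∸ i)) (upTo (suc k)))

one : Series
one k = if k ≡ᵇ 0 then + 1 else + 0

_^ˢ_ : Series → ℕ → Series
f ^ˢ zero = one
f ^ˢ suc m = f ⊛ (f ^ˢ m)

-- 1 - q^n  (for n ≥ 1)
oneMinusQ^ : ℕ → Series
oneMinusQ^ n k = if k ≡ᵇ 0 then + 1 else (if k ≡ᵇ n then ℤ.-[1+ 0 ] else + 0)

toℤSeries : (ℕ → ℕ) → Series
toℤSeries a k = + (a k)

-- the coordinate λ_0 (n ≥ 1 in the theorem; value for n = 0 irrelevant)
coord0 : {n : ℕ} → Vec ℤ n → ℤ
coord0 Vec.[] = + 0
coord0 (x Vec.∷ _) = x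

module Submission where

-- For μ = L_n λ one has Σᵢ μᵢ = λ₀ and Σᵢ (n - i) μᵢ = n (μ₀ + λ₁ - λ₀), by telescoping the second
-- differences in the middle rows. The middle rows also determine λ from λ₀ and λ₁, so λ ↦ L_n λ is a
-- bijection from the lattice points of the cone onto the μ ∈ ℕⁿ with n ∣ Σᵢ (n - i) μᵢ, and λ₀ = Σ μ.
-- Writing μᵢ = cᵢ + n tᵢ with 0 ≤ cᵢ < n leaves the congruence unchanged and contributes q^{n Σ t},
-- whence the factor (1 - qⁿ)⁻ⁿ; this is an induction on the number of coordinates that tracks the
-- residue of the partial weight.

open import Data.Bool using (Bool; true; false; if_then_else_; _∧_; _∨_)
open import Data.Empty using (⊥)
open import Data.Fin as Fin using (Fin; toℕ)
import Data.Fin.Properties as Fin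
import Data.Integer
open import Data.Integer as ℤ using (ℤ; +_; _+_; _*_; _-_; -1ℤ; 0ℤ; ∣_∣)
import Data.Integer.Properties as ℤ
open import Data.Integer.Tactic.RingSolver using (solve-∀)
open import Data.List as List using (List; []; _∷_; _++_; filter; length; concatMap; allFin)
import Data.List.Properties as List
open import Data.List.Membership.Propositional using (_∈_)
open import Data.List.Membership.Propositional.Properties
  using (∈-map⁺; ∈-map⁻; ∈-++⁺ˡ; ∈-++⁺ʳ; ∈-++⁻; ∈-filter⁺; ∈-filter⁻)
import Data.List.Relation.Unary.All as All
open import Data.List.Relation.Unary.All.Properties using (all-filter)
import Data.List.Relation.Unary.AllPairs as AllPairs
open import Data.List.Relation.Unary.Any using (here)
open import Data.List.Relation.Unary.Unique.Propositional using (Unique)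
import Data.List.Relation.Unary.Unique.Propositional.Properties as Unique
open import Data.Nat as ℕ using (ℕ; zero; suc; _≤_; _<_; z≤n; s≤s; _∸_; _≡ᵇ_; _≟_)
open import Data.Nat.DivMod using (_/_; m/n*n≡m)
open import Data.Nat.Divisibility using (_∣_; _∣?_; divides; ∣m+n∣m⇒∣n; ∣m∣n⇒∣m+n; m∣m*n; n∣m*n)
import Data.Nat.ListAction as ListSum
import Data.Nat.Properties as ℕ
import Data.Nat.Tactic.RingSolver as NatSolver
open import Data.Product using (Σ; _×_; _,_; proj₁; proj₂)
open import Data.Sum using (inj₁; inj₂)
open import Data.Vec as Vec using (Vec; []; _∷_)
import Data.Vec.Properties as Vec
open import Function using (_∘_; id)
open import Function.Bundles using (mk⇔)
open import Level using (0ℓ)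
open import Relation.Binary.PropositionalEquality
open import Relation.Nullary using (yes; no; does)
open import Relation.Nullary.Decidable using (_×-dec_)
open import Relation.Unary using (Pred; Decidable; _≐_)

open import Defs

-- Finite sums and power series

∑ℤ : ℕ → (ℕ → ℤ) → ℤ
∑ℤ zero    f = 0ℤ
∑ℤ (suc n) f = f 0 + ∑ℤ n (f ∘ suc)

∑ℕ : ℕ → (ℕ → ℕ) → ℕ
∑ℕ zero    f = 0
∑ℕ (suc n) f = f 0 ℕ.+ ∑ℕ n (f ∘ suc)

∑ℤ-cong-< : ∀ n {f g : ℕ → ℤ} → (∀ i → i < n → f i ≡ g i) → ∑ℤ n f ≡ ∑ℤ n g
∑ℤ-cong-< zero    f≡g = refl
∑ℤ-cong-< (suc n) f≡g = cong₂ _+_ (f≡g 0 (s≤s z≤n)) (∑ℤ-cong-< n (λ i i<n → f≡g (suc i) (s≤s i<n)))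

∑ℤ-cong : ∀ n {f g : ℕ → ℤ} → f ≗ g → ∑ℤ n f ≡ ∑ℤ n g
∑ℤ-cong n f≗g = ∑ℤ-cong-< n (λ i _ → f≗g i)

∑ℤ-distrib-+ : ∀ n (f g : ℕ → ℤ) → ∑ℤ n (λ i → f i + g i) ≡ ∑ℤ n f + ∑ℤ n g
∑ℤ-distrib-+ zero    f g = refl
∑ℤ-distrib-+ (suc n) f g =
  trans (cong (_+_ (f 0 + g 0)) (∑ℤ-distrib-+ n (f ∘ suc) (g ∘ suc))) (interchange (f 0) (g 0) _ _)
  where interchange : ∀ a b c d → a + b + (c + d) ≡ a + c + (b + d)
        interchange = solve-∀

∑ℤ-*ˡ : ∀ n c (f : ℕ → ℤ) → ∑ℤ n (λ i → c * f i) ≡ c * ∑ℤ n f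
∑ℤ-*ˡ zero    c f = sym (ℤ.*-zeroʳ c)
∑ℤ-*ˡ (suc n) c f =
  trans (cong (_+_ (c * f 0)) (∑ℤ-*ˡ n c (f ∘ suc))) (sym (ℤ.*-distribˡ-+ c (f 0) _))

∑ℤ-zero : ∀ n → ∑ℤ n (λ _ → 0ℤ) ≡ 0ℤ
∑ℤ-zero zero    = refl
∑ℤ-zero (suc n) = trans (ℤ.+-identityˡ _) (∑ℤ-zero n)

∑ℤ-nonneg : ∀ n (f : ℕ → ℤ) → (∀ i → i < n → 0ℤ ℤ.≤ f i) → 0ℤ ℤ.≤ ∑ℤ n f
∑ℤ-nonneg zero    f f≥0 = ℤ.+≤+ z≤n
∑ℤ-nonneg (suc n) f f≥0 =
  ℤ.+-mono-≤ (f≥0 0 (s≤s z≤n)) (∑ℤ-nonneg n (f ∘ suc) (λ i i<n → f≥0 (suc i) (s≤s i<n)))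

∑ℕ-snoc : ∀ n (f : ℕ → ℕ) → ∑ℕ (suc n) f ≡ ∑ℕ n f ℕ.+ f n
∑ℕ-snoc zero    f = ℕ.+-comm (f 0) 0
∑ℕ-snoc (suc n) f = trans (cong (f 0 ℕ.+_) (∑ℕ-snoc n (f ∘ suc))) (sym (ℕ.+-assoc (f 0) _ _))

+-∑ℕ : ∀ n (f : ℕ → ℕ) → + ∑ℕ n f ≡ ∑ℤ n (+_ ∘ f)
+-∑ℕ zero    f = refl
+-∑ℕ (suc n) f = trans (ℤ.pos-+ (f 0) _) (cong (_+_ (+ f 0)) (+-∑ℕ n (f ∘ suc)))

-- qᵈ F, where z is the zero of the coefficient type
shift : {A : Set} → A → ℕ → (ℕ → A) → ℕ → A
shift z zero    F k       = F k
shift z (suc d) F zero    = z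
shift z (suc d) F (suc k) = shift z d F k

module _ {A : Set} (z : A) where

  shift-cong : ∀ d {F G : ℕ → A} → F ≗ G → shift z d F ≗ shift z d G
  shift-cong zero    F≗G k       = F≗G k
  shift-cong (suc d) F≗G zero    = refl
  shift-cong (suc d) F≗G (suc k) = shift-cong d F≗G k

  shift-suc : ∀ d (F : ℕ → A) → shift z (suc d) F ≗ shift z 1 (shift z d F)
  shift-suc d F zero    = refl
  shift-suc d F (suc k) = refl

  shift-sucʳ : ∀ d (F : ℕ → A) → shift z d (shift z 1 F) ≗ shift z (suc d) F
  shift-sucʳ zero    F k       = refl
  shift-sucʳ (suc d) F zero    = refl
  shift-sucʳ (suc d) F (suc k) = shift-sucʳ d F k

shift-map : ∀ {A B : Set} (f : A → B) z d (F : ℕ → A) → (f ∘ shift z d F) ≗ shift (f z) d (f ∘ F)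
shift-map f z zero    F k       = refl
shift-map f z (suc d) F zero    = refl
shift-map f z (suc d) F (suc k) = shift-map f z d F k

shift-+ : ∀ d (F G : ℕ → ℕ) → shift 0 d (λ i → F i ℕ.+ G i) ≗ λ k → shift 0 d F k ℕ.+ shift 0 d G k
shift-+ zero    F G k       = refl
shift-+ (suc d) F G zero    = refl
shift-+ (suc d) F G (suc k) = shift-+ d F G k

infixl 6 _+ˢ_
infixl 7 _·ˢ_

_+ˢ_ : Series → Series → Series
(f +ˢ g) k = f k + g k

_·ˢ_ : ℤ → Series → Series
(c ·ˢ f) k = c * f k

conv : Series → Series → Series
conv f g k = ∑ℤ (suc k) (λ i → f i * g (k ∸ i))

⊛≗conv : ∀ f g → f ⊛ g ≗ conv f g
⊛≗conv f g k = foldr-applyUpTo (suc k) id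
  where
  foldr-applyUpTo : ∀ m (u : ℕ → ℕ) → List.foldr _+_ 0ℤ (List.map (λ i → f i * g (k ∸ i)) (List.applyUpTo u m))
                                     ≡ ∑ℤ m (λ i → f (u i) * g (k ∸ u i))
  foldr-applyUpTo zero    u = refl
  foldr-applyUpTo (suc m) u = cong (_+_ (f (u 0) * g (k ∸ u 0))) (foldr-applyUpTo m (u ∘ suc))

conv-congˡ : ∀ {f f'} g → f ≗ f' → conv f g ≗ conv f' g
conv-congˡ g f≗f' k = ∑ℤ-cong (suc k) (λ i → cong (_* g (k ∸ i)) (f≗f' i))

conv-congʳ : ∀ f {g g'} → g ≗ g' → conv f g ≗ conv f g'
conv-congʳ f g≗g' k = ∑ℤ-cong (suc k) (λ i → cong (f i *_) (g≗g' (k ∸ i)))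

conv-distribʳ-+ : ∀ f f' g → conv (f +ˢ f') g ≗ conv f g +ˢ conv f' g
conv-distribʳ-+ f f' g k =
  trans (∑ℤ-cong (suc k) (λ i → ℤ.*-distribʳ-+ (g (k ∸ i)) (f i) (f' i)))
        (∑ℤ-distrib-+ (suc k) (λ i → f i * g (k ∸ i)) (λ i → f' i * g (k ∸ i)))

conv-distribˡ-+ : ∀ f g g' → conv f (g +ˢ g') ≗ conv f g +ˢ conv f g'
conv-distribˡ-+ f g g' k =
  trans (∑ℤ-cong (suc k) (λ i → ℤ.*-distribˡ-+ (f i) (g (k ∸ i)) (g' (k ∸ i))))
        (∑ℤ-distrib-+ (suc k) (λ i → f i * g (k ∸ i)) (λ i → f i * g' (k ∸ i)))

conv-*ˡ : ∀ c f g → conv (c ·ˢ f) g ≗ c ·ˢ conv f g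
conv-*ˡ c f g k =
  trans (∑ℤ-cong (suc k) (λ i → ℤ.*-assoc c (f i) (g (k ∸ i))))
        (∑ℤ-*ˡ (suc k) c (λ i → f i * g (k ∸ i)))

conv-*ʳ : ∀ c f g → conv f (c ·ˢ g) ≗ c ·ˢ conv f g
conv-*ʳ c f g k =
  trans (∑ℤ-cong (suc k) (λ i → swap (f i) (g (k ∸ i))))
        (∑ℤ-*ˡ (suc k) c (λ i → f i * g (k ∸ i)))
  where swap : ∀ a b → a * (c * b) ≡ c * (a * b)
        swap a b = trans (sym (ℤ.*-assoc a c b))
                         (trans (cong (_* b) (ℤ.*-comm a c)) (ℤ.*-assoc c a b))

conv-zeroˡ : ∀ g → conv (λ _ → 0ℤ) g ≗ λ _ → 0ℤ
conv-zeroˡ g k = trans (∑ℤ-cong (suc k) (λ i → ℤ.*-zeroˡ (g (k ∸ i)))) (∑ℤ-zero (suc k))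

conv-identityʳ : ∀ f → conv f one ≗ f
conv-identityʳ f zero    = trans (ℤ.+-identityʳ _) (ℤ.*-identityʳ (f 0))
conv-identityʳ f (suc k) =
  trans (cong₂ _+_ (ℤ.*-zeroʳ (f 0)) (conv-identityʳ (f ∘ suc) k)) (ℤ.+-identityˡ _)

-- conv f g ∘ suc is (f 0 ·ˢ (g ∘ suc)) +ˢ conv (f ∘ suc) g on the nose, which drives the induction.
conv-assoc : ∀ f g h → conv (conv f g) h ≗ conv f (conv g h)
conv-assoc f g h zero = ring (f 0) (g 0) (h 0)
  where ring : ∀ a b c → (a * b + 0ℤ) * c + 0ℤ ≡ a * (b * c + 0ℤ) + 0ℤ
        ring = solve-∀
conv-assoc f g h (suc k) = begin
  (f 0 * g 0 + 0ℤ) * h (suc k) + conv (conv f g ∘ suc) h k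
    ≡⟨ cong (_+_ ((f 0 * g 0 + 0ℤ) * h (suc k))) (conv-distribʳ-+ (f 0 ·ˢ (g ∘ suc)) (conv (f ∘ suc) g) h k) ⟩
  (f 0 * g 0 + 0ℤ) * h (suc k) + (conv (f 0 ·ˢ (g ∘ suc)) h k + conv (conv (f ∘ suc) g) h k)
    ≡⟨ cong₂ (λ x y → (f 0 * g 0 + 0ℤ) * h (suc k) + (x + y))
             (conv-*ˡ (f 0) (g ∘ suc) h k) (conv-assoc (f ∘ suc) g h k) ⟩
  (f 0 * g 0 + 0ℤ) * h (suc k) + (f 0 * conv (g ∘ suc) h k + conv (f ∘ suc) (conv g h) k)
    ≡⟨ ring (f 0) (g 0) (h (suc k)) _ _ ⟩
  f 0 * (g 0 * h (suc k) + conv (g ∘ suc) h k) + conv (f ∘ suc) (conv g h) k ∎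
  where
  open ≡-Reasoning
  ring : ∀ a b c x y → (a * b + 0ℤ) * c + (a * x + y) ≡ a * (b * c + x) + y
  ring = solve-∀

conv-∑ : ∀ N (F : ℕ → Series) G →
         conv (λ j → ∑ℤ N (λ x → F x j)) G ≗ λ k → ∑ℤ N (λ x → conv (F x) G k)
conv-∑ zero    F G k = conv-zeroˡ G k
conv-∑ (suc N) F G k =
  trans (conv-distribʳ-+ (F 0) (λ j → ∑ℤ N (λ x → F (suc x) j)) G k)
        (cong (_+_ (conv (F 0) G k)) (conv-∑ N (F ∘ suc) G k))

conv-shiftˡ : ∀ d F G → conv (shift 0ℤ d F) G ≗ shift 0ℤ d (conv F G)
conv-shiftˡ zero    F G k       = refl
conv-shiftˡ (suc d) F G zero    = trans (ℤ.+-identityʳ _) (ℤ.*-zeroˡ (G 0))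
conv-shiftˡ (suc d) F G (suc k) =
  trans (cong (_+ conv (shift 0ℤ d F) G k) (ℤ.*-zeroˡ (G (suc k))))
        (trans (ℤ.+-identityˡ _) (conv-shiftˡ d F G k))

conv-shiftʳ : ∀ d F G → conv F (shift 0ℤ d G) ≗ shift 0ℤ d (conv F G)
conv-shiftʳ zero    F G k = refl
conv-shiftʳ (suc d) F G k = begin
  conv F (shift 0ℤ (suc d) G) k        ≡⟨ conv-congʳ F (shift-suc 0ℤ d G) k ⟩
  conv F (shift 0ℤ 1 (shift 0ℤ d G)) k  ≡⟨ conv-shift₁ʳ F (shift 0ℤ d G) k ⟩
  shift 0ℤ 1 (conv F (shift 0ℤ d G)) k  ≡⟨ shift-cong 0ℤ 1 (conv-shiftʳ d F G) k ⟩
  shift 0ℤ 1 (shift 0ℤ d (conv F G)) k  ≡⟨ shift-suc 0ℤ d (conv F G) k ⟨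
  shift 0ℤ (suc d) (conv F G) k        ∎
  where
  open ≡-Reasoning
  conv-shift₁ʳ : ∀ F G → conv F (shift 0ℤ 1 G) ≗ shift 0ℤ 1 (conv F G)
  conv-shift₁ʳ F G zero          = trans (ℤ.+-identityʳ _) (ℤ.*-zeroʳ (F 0))
  conv-shift₁ʳ F G (suc zero)    = cong (_+_ (F 0 * G 0)) (conv-shift₁ʳ (F ∘ suc) G zero)
  conv-shift₁ʳ F G (suc (suc k)) = cong (_+_ (F 0 * G (suc k))) (conv-shift₁ʳ (F ∘ suc) G (suc k))

conv-oneMinusQ^ : ∀ n′ (F H : Series) → F ≗ H +ˢ shift 0ℤ (suc n′) F → conv F (oneMinusQ^ (suc n′)) ≗ H
conv-oneMinusQ^ n′ F H F≗H+qⁿF k = begin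
  conv F (oneMinusQ^ n) k
    ≡⟨ conv-congʳ F oneMinusQ^-split k ⟩
  conv F (one +ˢ -1ℤ ·ˢ shift 0ℤ n one) k
    ≡⟨ conv-distribˡ-+ F one (-1ℤ ·ˢ shift 0ℤ n one) k ⟩
  conv F one k + conv F (-1ℤ ·ˢ shift 0ℤ n one) k
    ≡⟨ cong₂ _+_ (conv-identityʳ F k) (conv-*ʳ -1ℤ F (shift 0ℤ n one) k) ⟩
  F k + -1ℤ * conv F (shift 0ℤ n one) k
    ≡⟨ cong (λ x → F k + -1ℤ * x) (conv-shiftʳ n F one k) ⟩
  F k + -1ℤ * shift 0ℤ n (conv F one) k
    ≡⟨ cong (λ x → F k + -1ℤ * x) (shift-cong 0ℤ n (conv-identityʳ F) k) ⟩
  F k + -1ℤ * shift 0ℤ n F k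
    ≡⟨ cong (λ x → x + -1ℤ * shift 0ℤ n F k) (F≗H+qⁿF k) ⟩
  H k + shift 0ℤ n F k + -1ℤ * shift 0ℤ n F k
    ≡⟨ cancel (H k) (shift 0ℤ n F k) ⟩
  H k ∎
  where
  open ≡-Reasoning
  n : ℕ
  n = suc n′
  cancel : ∀ a b → a + b + -1ℤ * b ≡ a
  cancel = solve-∀
  shift-one : ∀ d j → shift 0ℤ d one j ≡ (if j ≡ᵇ d then + 1 else 0ℤ)
  shift-one zero    zero    = refl
  shift-one zero    (suc j) = refl
  shift-one (suc d) zero    = refl
  shift-one (suc d) (suc j) = shift-one d j
  oneMinusQ^-split : oneMinusQ^ n ≗ one +ˢ -1ℤ ·ˢ shift 0ℤ n one
  oneMinusQ^-split zero    = refl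
  oneMinusQ^-split (suc j) rewrite shift-one n′ j with j ≡ᵇ n′
  ... | true  = refl
  ... | false = refl

-- Counting compositions by weight residue

module _ {A : Set} {P : Pred A 0ℓ} (P? : Decidable P) where

  length-filter-++ : ∀ xs ys → length (filter P? (xs ++ ys)) ≡ length (filter P? xs) ℕ.+ length (filter P? ys)
  length-filter-++ xs ys = trans (cong length (List.filter-++ P? xs ys)) (List.length-++ (filter P? xs))

  length-filter-map : ∀ {B : Set} (f : B → A) xs → length (filter P? (List.map f xs)) ≡ length (filter (P? ∘ f) xs)
  length-filter-map f []       = refl
  length-filter-map f (x ∷ xs) with does (P? (f x))
  ... | true  = cong suc (length-filter-map f xs)
  ... | false = length-filter-map f xs

  length-filter-concatMap : ∀ {B : Set} (f : B → List A) xs →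
    length (filter P? (concatMap f xs)) ≡ List.foldr (λ y acc → length (filter P? (f y)) ℕ.+ acc) 0 xs
  length-filter-concatMap f []       = refl
  length-filter-concatMap f (x ∷ xs) =
    trans (length-filter-++ (f x) (concatMap f xs)) (cong (_ ℕ.+_) (length-filter-concatMap f xs))

length-filter-≐ : ∀ {A : Set} {P Q : Pred A 0ℓ} (P? : Decidable P) (Q? : Decidable Q) → P ≐ Q →
                  ∀ xs → length (filter P? xs) ≡ length (filter Q? xs)
length-filter-≐ P? Q? P≐Q xs = cong length (List.filter-≐ P? Q? P≐Q xs)

∣-≐ : ∀ {A : Set} {n} {f g : A → ℕ} → (∀ x → f x ≡ g x) → (λ x → n ∣ f x) ≐ (λ x → n ∣ g x)
∣-≐ {n = n} f≡g = (λ {x} → subst (n ∣_) (f≡g x)) , (λ {x} → subst (n ∣_) (sym (f≡g x)))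

length-filter-shift : ∀ {A : Set} {Q : Pred A 0ℓ} (Q? : Decidable Q) (φ : A → ℕ) xs a k →
  length (filter (λ c → Q? c ×-dec (a ℕ.+ φ c ≟ k)) xs)
    ≡ shift 0 a (λ k′ → length (filter (λ c → Q? c ×-dec (φ c ≟ k′)) xs)) k
length-filter-shift Q? φ xs zero    k       = refl
length-filter-shift Q? φ xs (suc a) zero    =
  cong length (List.filter-none _ (All.universal (λ _ → λ ()) xs))
length-filter-shift Q? φ xs (suc a) (suc k) =
  trans (length-filter-≐ _ _ ((λ (q , e) → q , ℕ.suc-injective e) , (λ (q , e) → q , cong suc e)) xs)
        (length-filter-shift Q? φ xs a k)

wt : ∀ {m} → Vec ℕ m → ℕ
wt []               = 0
wt {suc m} (x ∷ xs) = suc m ℕ.* x ℕ.+ wt xs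

incrHead : ∀ {m} → Vec ℕ (suc m) → Vec ℕ (suc m)
incrHead (x ∷ xs) = suc x ∷ xs

compositions : (m k : ℕ) → List (Vec ℕ m)
compositions zero    zero    = [] ∷ []
compositions zero    (suc k) = []
compositions (suc m) zero    = List.map (0 ∷_) (compositions m zero)
compositions (suc m) (suc k) =
  List.map (0 ∷_) (compositions m (suc k)) ++ List.map incrHead (compositions (suc m) k)

∈-compositions⁺ : ∀ m k (μ : Vec ℕ m) → Vec.sum μ ≡ k → μ ∈ compositions m k
∈-compositions⁺ zero    zero    []          _ = here refl
∈-compositions⁺ (suc m) zero    (zero ∷ μ)  e = ∈-map⁺ (0 ∷_) (∈-compositions⁺ m zero μ e)
∈-compositions⁺ (suc m) (suc k) (zero ∷ μ)  e = ∈-++⁺ˡ (∈-map⁺ (0 ∷_) (∈-compositions⁺ m (suc k) μ e))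
∈-compositions⁺ (suc m) (suc k) (suc x ∷ μ) e =
  ∈-++⁺ʳ (List.map (0 ∷_) (compositions m (suc k)))
         (∈-map⁺ incrHead (∈-compositions⁺ (suc m) k (x ∷ μ) (ℕ.suc-injective e)))

∈-compositions⁻ : ∀ m k (μ : Vec ℕ m) → μ ∈ compositions m k → Vec.sum μ ≡ k
∈-compositions⁻ zero    zero    [] _ = refl
∈-compositions⁻ (suc m) zero    μ μ∈ with ∈-map⁻ (0 ∷_) μ∈
... | ν , ν∈ , refl = ∈-compositions⁻ m zero ν ν∈
∈-compositions⁻ (suc m) (suc k) μ μ∈ with ∈-++⁻ (List.map (0 ∷_) (compositions m (suc k))) μ∈
... | inj₁ μ∈₁ with ∈-map⁻ (0 ∷_) μ∈₁
...   | ν , ν∈ , refl = ∈-compositions⁻ m (suc k) ν ν∈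
∈-compositions⁻ (suc m) (suc k) μ μ∈ | inj₂ μ∈₂ with ∈-map⁻ incrHead μ∈₂
...   | (x ∷ ν) , ν∈ , refl = cong suc (∈-compositions⁻ (suc m) k (x ∷ ν) ν∈)

compositions-unique : ∀ m k → Unique (compositions m k)
compositions-unique zero    zero    = All.[] AllPairs.∷ AllPairs.[]
compositions-unique zero    (suc k) = AllPairs.[]
compositions-unique (suc m) zero    = Unique.map⁺ Vec.∷-injectiveʳ (compositions-unique m zero)
compositions-unique (suc m) (suc k) =
  Unique.++⁺ (Unique.map⁺ Vec.∷-injectiveʳ (compositions-unique m (suc k)))
             (Unique.map⁺ incrHead-injective (compositions-unique (suc m) k))
             disjoint
  where
  incrHead-injective : ∀ {μ ν : Vec ℕ (suc m)} → incrHead μ ≡ incrHead ν → μ ≡ ν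
  incrHead-injective {_ ∷ _} {_ ∷ _} e = cong₂ _∷_ (ℕ.suc-injective (Vec.∷-injectiveˡ e)) (Vec.∷-injectiveʳ e)
  disjoint : ∀ {μ} → μ ∈ List.map (0 ∷_) (compositions m (suc k))
                   × μ ∈ List.map incrHead (compositions (suc m) k) → ⊥
  disjoint (μ∈₁ , μ∈₂) with ∈-map⁻ (0 ∷_) μ∈₁ | ∈-map⁻ incrHead μ∈₂
  ... | _ , _ , refl | (_ ∷ _) , _ , ()

module Counting (n′ : ℕ) where

  n : ℕ
  n = suc n′

  divides? : ∀ {m} r → Decidable (λ (μ : Vec ℕ m) → n ∣ r ℕ.+ wt μ)
  divides? r μ = n ∣? r ℕ.+ wt μ

  residue? : ∀ {m} r k →
    Decidable (λ (c : Vec (Fin n) m) → n ∣ r ℕ.+ wt (Vec.map toℕ c) × Vec.sum (Vec.map toℕ c) ≡ k)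
  residue? r k c = divides? r (Vec.map toℕ c) ×-dec (Vec.sum (Vec.map toℕ c) ≟ k)

  -- r is the weight already contributed by the coordinates fixed so far.
  compCount : ℕ → ℕ → ℕ → ℕ
  compCount m r k = length (filter (divides? r) (compositions m k))

  residueCount : ℕ → ℕ → ℕ → ℕ
  residueCount m r k = length (filter (residue? r k) (allVecs n m))

  compCount-periodic : ∀ m r s → compCount m (r ℕ.+ s ℕ.* n) ≗ compCount m r
  compCount-periodic m r s k = length-filter-≐ _ _ ((λ {μ} → drop {μ}) , (λ {μ} → add {μ})) (compositions m k)
    where
    rearrange : ∀ w → r ℕ.+ s ℕ.* n ℕ.+ w ≡ s ℕ.* n ℕ.+ (r ℕ.+ w)
    rearrange w = trans (cong (ℕ._+ w) (ℕ.+-comm r (s ℕ.* n))) (ℕ.+-assoc (s ℕ.* n) r w)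
    drop : ∀ {μ : Vec ℕ m} → n ∣ r ℕ.+ s ℕ.* n ℕ.+ wt μ → n ∣ r ℕ.+ wt μ
    drop {μ} d = ∣m+n∣m⇒∣n (subst (n ∣_) (rearrange (wt μ)) d) (n∣m*n s)
    add : ∀ {μ : Vec ℕ m} → n ∣ r ℕ.+ wt μ → n ∣ r ℕ.+ s ℕ.* n ℕ.+ wt μ
    add {μ} d = subst (n ∣_) (sym (rearrange (wt μ))) (∣m∣n⇒∣m+n (n∣m*n s) d)

  -- Either μ₀ = 0, or μ₀ > 0 and decrementing μ₀ lowers wt μ by m + 1.
  compCount-step : ∀ m r →
    compCount (suc m) r ≗ λ k → compCount m r k ℕ.+ shift 0 1 (compCount (suc m) (r ℕ.+ suc m)) k
  compCount-step m r zero =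
    trans (length-filter-map _ (0 ∷_) (compositions m zero))
          (trans (length-filter-≐ _ _ (∣-≐ zero-head) (compositions m zero)) (sym (ℕ.+-identityʳ _)))
    where zero-head : ∀ μ → r ℕ.+ (suc m ℕ.* 0 ℕ.+ wt μ) ≡ r ℕ.+ wt μ
          zero-head μ = cong (λ x → r ℕ.+ (x ℕ.+ wt μ)) (ℕ.*-zeroʳ m)
  compCount-step m r (suc k) =
    trans (length-filter-++ _ (List.map (0 ∷_) (compositions m (suc k))) (List.map incrHead (compositions (suc m) k)))
          (cong₂ ℕ._+_
            (trans (length-filter-map _ (0 ∷_) (compositions m (suc k)))
                   (length-filter-≐ _ _ (∣-≐ zero-head) (compositions m (suc k))))
            (trans (length-filter-map _ incrHead (compositions (suc m) k))
                   (length-filter-≐ _ _ (∣-≐ incr-head) (compositions (suc m) k))))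
    where
    zero-head : ∀ μ → r ℕ.+ (suc m ℕ.* 0 ℕ.+ wt μ) ≡ r ℕ.+ wt μ
    zero-head μ = cong (λ x → r ℕ.+ (x ℕ.+ wt μ)) (ℕ.*-zeroʳ m)
    incr-head : ∀ (μ : Vec ℕ (suc m)) → r ℕ.+ wt (incrHead μ) ≡ r ℕ.+ suc m ℕ.+ wt μ
    incr-head (x ∷ μ) = ring r m x (wt μ)
      where ring : ∀ r m x w → r ℕ.+ (suc m ℕ.* suc x ℕ.+ w) ≡ r ℕ.+ suc m ℕ.+ (suc m ℕ.* x ℕ.+ w)
            ring = NatSolver.solve-∀

  compCount-unroll : ∀ x m r →
    compCount (suc m) r ≗ λ k → ∑ℕ x (λ y → shift 0 y (compCount m (r ℕ.+ suc m ℕ.* y)) k)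
                                  ℕ.+ shift 0 x (compCount (suc m) (r ℕ.+ suc m ℕ.* x)) k
  compCount-unroll zero    m r k = cong (λ s → compCount (suc m) s k) (sym (r+m*0≡r))
    where r+m*0≡r : r ℕ.+ suc m ℕ.* 0 ≡ r
          r+m*0≡r = trans (cong (r ℕ.+_) (ℕ.*-zeroʳ (suc m))) (ℕ.+-identityʳ r)
  compCount-unroll (suc x) m r k = begin
    compCount (suc m) r k
      ≡⟨ compCount-unroll x m r k ⟩
    ∑ℕ x G ℕ.+ shift 0 x (compCount (suc m) rₓ) k
      ≡⟨ cong (∑ℕ x G ℕ.+_) (shift-cong 0 x (compCount-step m rₓ) k) ⟩
    ∑ℕ x G ℕ.+ shift 0 x (λ j → compCount m rₓ j ℕ.+ shift 0 1 (compCount (suc m) (rₓ ℕ.+ suc m)) j) k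
      ≡⟨ cong (∑ℕ x G ℕ.+_) (shift-+ x (compCount m rₓ) _ k) ⟩
    ∑ℕ x G ℕ.+ (G x ℕ.+ shift 0 x (shift 0 1 (compCount (suc m) (rₓ ℕ.+ suc m))) k)
      ≡⟨ cong (λ t → ∑ℕ x G ℕ.+ (G x ℕ.+ t)) (shift-sucʳ 0 x _ k) ⟩
    ∑ℕ x G ℕ.+ (G x ℕ.+ shift 0 (suc x) (compCount (suc m) (rₓ ℕ.+ suc m)) k)
      ≡⟨ sym (ℕ.+-assoc (∑ℕ x G) (G x) _) ⟩
    ∑ℕ x G ℕ.+ G x ℕ.+ shift 0 (suc x) (compCount (suc m) (rₓ ℕ.+ suc m)) k
      ≡⟨ cong₂ ℕ._+_ (sym (∑ℕ-snoc x G))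
                     (cong (λ s → shift 0 (suc x) (compCount (suc m) s) k) rₓ+m≡rₓ₊₁) ⟩
    ∑ℕ (suc x) G ℕ.+ shift 0 (suc x) (compCount (suc m) (r ℕ.+ suc m ℕ.* suc x)) k ∎
    where
    open ≡-Reasoning
    G : ℕ → ℕ
    G y = shift 0 y (compCount m (r ℕ.+ suc m ℕ.* y)) k
    rₓ : ℕ
    rₓ = r ℕ.+ suc m ℕ.* x
    rₓ+m≡rₓ₊₁ : rₓ ℕ.+ suc m ≡ r ℕ.+ suc m ℕ.* suc x
    rₓ+m≡rₓ₊₁ = trans (ℕ.+-assoc r _ _)
                      (cong (r ℕ.+_) (trans (ℕ.+-comm (suc m ℕ.* x) (suc m)) (sym (ℕ.*-suc (suc m) x))))

  -- After n unrolling steps the residue r + (m + 1) n is back in the class of r.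
  compCount-recurrence : ∀ m r →
    toℤSeries (compCount (suc m) r)
      ≗ (λ k → ∑ℤ n (λ y → shift 0ℤ y (toℤSeries (compCount m (r ℕ.+ suc m ℕ.* y))) k))
        +ˢ shift 0ℤ n (toℤSeries (compCount (suc m) r))
  compCount-recurrence m r k = begin
    + compCount (suc m) r k
      ≡⟨ cong +_ (compCount-unroll n m r k) ⟩
    + (∑ℕ n G ℕ.+ shift 0 n (compCount (suc m) (r ℕ.+ suc m ℕ.* n)) k)
      ≡⟨ cong (λ t → + (∑ℕ n G ℕ.+ t)) (shift-cong 0 n (compCount-periodic (suc m) r (suc m)) k) ⟩
    + (∑ℕ n G ℕ.+ shift 0 n (compCount (suc m) r) k)
      ≡⟨ ℤ.pos-+ (∑ℕ n G) _ ⟩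
    + ∑ℕ n G + + shift 0 n (compCount (suc m) r) k
      ≡⟨ cong₂ _+_ (trans (+-∑ℕ n G)
                          (∑ℤ-cong n (λ y → shift-map +_ 0 y (compCount m (r ℕ.+ suc m ℕ.* y)) k)))
                   (shift-map +_ 0 n (compCount (suc m) r) k) ⟩
    ∑ℤ n (λ y → shift 0ℤ y (toℤSeries (compCount m (r ℕ.+ suc m ℕ.* y))) k)
      + shift 0ℤ n (toℤSeries (compCount (suc m) r)) k ∎
    where
    open ≡-Reasoning
    G : ℕ → ℕ
    G y = shift 0 y (compCount m (r ℕ.+ suc m ℕ.* y)) k

  residueCount-suc : ∀ m r k →
    residueCount (suc m) r k ≡ ∑ℕ n (λ x → shift 0 x (residueCount m (r ℕ.+ suc m ℕ.* x)) k)
  residueCount-suc m r k =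
    trans (length-filter-concatMap P? (λ x → List.map (x ∷_) (allVecs n m)) (allFin n))
          (foldr-+-tabulate n id {λ x → shift 0 x (residueCount m (r ℕ.+ suc m ℕ.* x)) k} head-count)
    where
    P? : Decidable (λ (c : Vec (Fin n) (suc m)) → n ∣ r ℕ.+ wt (Vec.map toℕ c) × Vec.sum (Vec.map toℕ c) ≡ k)
    P? = residue? r k
    foldr-+-tabulate : ∀ N (u : Fin N → Fin n) {g : ℕ → ℕ} →
      (∀ i → length (filter P? (List.map (u i ∷_) (allVecs n m))) ≡ g (toℕ i)) →
      List.foldr (λ y acc → length (filter P? (List.map (y ∷_) (allVecs n m))) ℕ.+ acc) 0 (List.tabulate u) ≡ ∑ℕ N g
    foldr-+-tabulate zero    u e = refl
    foldr-+-tabulate (suc N) u e = cong₂ ℕ._+_ (e Fin.zero) (foldr-+-tabulate N (u ∘ Fin.suc) (e ∘ Fin.suc))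
    head-count : ∀ i → length (filter P? (List.map (i ∷_) (allVecs n m)))
                         ≡ shift 0 (toℕ i) (residueCount m (r ℕ.+ suc m ℕ.* toℕ i)) k
    head-count i =
      trans (length-filter-map P? (i ∷_) (allVecs n m))
            (trans (length-filter-≐ _ _ ((λ (d , e) → subst (n ∣_) (sym (ℕ.+-assoc r _ _)) d , e)
                                       , (λ (d , e) → subst (n ∣_) (ℕ.+-assoc r _ _) d , e)) (allVecs n m))
                   (length-filter-shift (λ c → n ∣? r ℕ.+ suc m ℕ.* toℕ i ℕ.+ wt (Vec.map toℕ c))
                                        (Vec.sum ∘ Vec.map toℕ) (allVecs n m) (toℕ i) k))

  compCount≡residueCount₀ : ∀ r → compCount 0 r ≗ residueCount 0 r
  compCount≡residueCount₀ r zero with n ∣? r ℕ.+ 0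
  ... | yes d = trans (cong length (List.filter-accept (divides? r) d))
                      (sym (cong length (List.filter-accept (residue? r 0) (d , refl))))
  ... | no ¬d = trans (cong length (List.filter-reject (divides? r) ¬d))
                      (sym (cong length (List.filter-reject (residue? r 0) (¬d ∘ proj₁))))
  compCount≡residueCount₀ r (suc k) = sym (cong length (List.filter-reject (residue? r (suc k)) λ ()))

  compCount-gf : ∀ m r → conv (toℤSeries (compCount m r)) (oneMinusQ^ n ^ˢ m) ≗ toℤSeries (residueCount m r)
  compCount-gf zero    r k = trans (conv-identityʳ (toℤSeries (compCount 0 r)) k) (cong +_ (compCount≡residueCount₀ r k))
  compCount-gf (suc m) r k = begin
    conv F (P ^ˢ suc m) k
      ≡⟨ conv-congʳ F (⊛≗conv P (P ^ˢ m)) k ⟩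
    conv F (conv P (P ^ˢ m)) k
      ≡⟨ conv-assoc F P (P ^ˢ m) k ⟨
    conv (conv F P) (P ^ˢ m) k
      ≡⟨ conv-congˡ (P ^ˢ m) (conv-oneMinusQ^ n′ F H (compCount-recurrence m r)) k ⟩
    conv H (P ^ˢ m) k
      ≡⟨ conv-∑ n (λ y → shift 0ℤ y (G y)) (P ^ˢ m) k ⟩
    ∑ℤ n (λ y → conv (shift 0ℤ y (G y)) (P ^ˢ m) k)
      ≡⟨ ∑ℤ-cong n (λ y → trans (conv-shiftˡ y (G y) (P ^ˢ m) k) (shift-cong 0ℤ y (compCount-gf m (rᵧ y)) k)) ⟩
    ∑ℤ n (λ y → shift 0ℤ y (toℤSeries (residueCount m (rᵧ y))) k)
      ≡⟨ ∑ℤ-cong n (λ y → shift-map +_ 0 y (residueCount m (rᵧ y)) k) ⟨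
    ∑ℤ n (λ y → + shift 0 y (residueCount m (rᵧ y)) k)
      ≡⟨ +-∑ℕ n (λ y → shift 0 y (residueCount m (rᵧ y)) k) ⟨
    + ∑ℕ n (λ y → shift 0 y (residueCount m (rᵧ y)) k)
      ≡⟨ cong +_ (residueCount-suc m r k) ⟨
    + residueCount (suc m) r k ∎
    where
    open ≡-Reasoning
    P F H : Series
    P = oneMinusQ^ n
    F = toℤSeries (compCount (suc m) r)
    rᵧ : ℕ → ℕ
    rᵧ y = r ℕ.+ suc m ℕ.* y
    G : ℕ → Series
    G y = toℤSeries (compCount m (rᵧ y))
    H k = ∑ℤ n (λ y → shift 0ℤ y (G y) k)

  numCoeff≡residueCount : ∀ k → numCoeff n k ≡ residueCount n 0 k
  numCoeff≡residueCount k = length-filter-≐ _ (residue? 0 k) ((λ {c} → to c) , (λ {c} → from c)) (allVecs n n)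
    where
    listSum-wt : ∀ {m} (c : Vec (Fin n) m) →
      ListSum.sum (List.tabulate (λ j → (m ∸ toℕ j) ℕ.* toℕ (Vec.lookup c j))) ≡ wt (Vec.map toℕ c)
    listSum-wt []      = refl
    listSum-wt (x ∷ c) = cong (_ ℕ.+_) (listSum-wt c)
    listSum-sum : ∀ {m} (c : Vec (Fin n) m) →
      ListSum.sum (List.tabulate (λ j → toℕ (Vec.lookup c j))) ≡ Vec.sum (Vec.map toℕ c)
    listSum-sum []      = refl
    listSum-sum (x ∷ c) = cong (_ ℕ.+_) (listSum-sum c)
    -- weight ignores c₀, whose coefficient n in wt is invisible modulo n
    weight≡wt-tail : ∀ x (c : Vec (Fin n) n′) → weight n (x ∷ c) ≡ wt (Vec.map toℕ c)
    weight≡wt-tail x c =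
      trans (cong ListSum.sum (List.map-tabulate id
                (λ j → if toℕ j ≡ᵇ 0 then 0 else (n ∸ toℕ j) ℕ.* toℕ (Vec.lookup (x ∷ c) j))))
            (listSum-wt c)
    phi≡sum : ∀ c → phi n c ≡ Vec.sum (Vec.map toℕ c)
    phi≡sum c = trans (cong ListSum.sum (List.map-tabulate id (λ j → toℕ (Vec.lookup c j)))) (listSum-sum c)
    to : ∀ c → n ∣ weight n c × phi n c ≡ k → n ∣ wt (Vec.map toℕ c) × Vec.sum (Vec.map toℕ c) ≡ k
    to (x ∷ c) (d , e) = ∣m∣n⇒∣m+n (m∣m*n (toℕ x)) (subst (n ∣_) (weight≡wt-tail x c) d)
                       , trans (sym (phi≡sum (x ∷ c))) e
    from : ∀ c → n ∣ wt (Vec.map toℕ c) × Vec.sum (Vec.map toℕ c) ≡ k → n ∣ weight n c × phi n c ≡ k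
    from (x ∷ c) (d , e) = subst (n ∣_) (sym (weight≡wt-tail x c)) (∣m+n∣m⇒∣n d (m∣m*n (toℕ x)))
                         , trans (phi≡sum (x ∷ c)) e

-- Rows of L_n

-- cycleAdj and Lmat with ℕ indices: Lmat n i j reduces to Lmatℕ n (toℕ i) (toℕ j).
cycleAdjℕ : ℕ → ℕ → ℕ → Bool
cycleAdjℕ n a b =
  (b ≡ᵇ suc a) ∨ (a ≡ᵇ suc b) ∨ ((a ≡ᵇ 0) ∧ (b ≡ᵇ (n ∸ 1))) ∨ ((b ≡ᵇ 0) ∧ (a ≡ᵇ (n ∸ 1)))

Lmatℕ : ℕ → ℕ → ℕ → ℤ
Lmatℕ n a b =
  if a ≡ᵇ b then (if a ≡ᵇ 0 then + 3 else + 2) else (if cycleAdjℕ n a b then -1ℤ else 0ℤ)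

Lrow : ℕ → (ℕ → ℤ) → ℕ → ℤ
Lrow n V a = ∑ℤ n (λ b → Lmatℕ n a b * V b)

δ : ℕ → ℕ → ℤ
δ c b = if b ≡ᵇ c then + 1 else 0ℤ

∑ℤ-δ : ∀ N c (V : ℕ → ℤ) → c < N → ∑ℤ N (λ b → δ c b * V b) ≡ V c
∑ℤ-δ (suc N) zero    V _ =
  trans (cong₂ _+_ (ℤ.*-identityˡ (V 0)) (trans (∑ℤ-cong N (λ b → ℤ.*-zeroˡ (V (suc b)))) (∑ℤ-zero N)))
        (ℤ.+-identityʳ (V 0))
∑ℤ-δ (suc N) (suc c) V (s≤s c<N) =
  trans (cong₂ _+_ (ℤ.*-zeroˡ (V 0)) (∑ℤ-δ N c (V ∘ suc) c<N)) (ℤ.+-identityˡ (V (suc c)))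

∑ℤ-three-point : ∀ N α c₁ c₂ c₃ (V : ℕ → ℤ) → c₁ < N → c₂ < N → c₃ < N →
  ∑ℤ N (λ b → (α * δ c₁ b + -1ℤ * δ c₂ b + -1ℤ * δ c₃ b) * V b) ≡ α * V c₁ - V c₂ - V c₃
∑ℤ-three-point N α c₁ c₂ c₃ V c₁<N c₂<N c₃<N = begin
  ∑ℤ N (λ b → (α * δ c₁ b + -1ℤ * δ c₂ b + -1ℤ * δ c₃ b) * V b)
    ≡⟨ ∑ℤ-cong N (λ b → distrib α (δ c₁ b) (δ c₂ b) (δ c₃ b) (V b)) ⟩
  ∑ℤ N (λ b → α * (δ c₁ b * V b) + -1ℤ * (δ c₂ b * V b) + -1ℤ * (δ c₃ b * V b))
    ≡⟨ trans (∑ℤ-distrib-+ N _ (λ b → -1ℤ * (δ c₃ b * V b)))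
             (cong (_+ _) (∑ℤ-distrib-+ N (λ b → α * (δ c₁ b * V b)) (λ b → -1ℤ * (δ c₂ b * V b)))) ⟩
  ∑ℤ N (λ b → α * (δ c₁ b * V b)) + ∑ℤ N (λ b → -1ℤ * (δ c₂ b * V b))
    + ∑ℤ N (λ b → -1ℤ * (δ c₃ b * V b))
    ≡⟨ cong₂ _+_ (cong₂ _+_ (pick α c₁ c₁<N) (pick -1ℤ c₂ c₂<N)) (pick -1ℤ c₃ c₃<N) ⟩
  α * V c₁ + -1ℤ * V c₂ + -1ℤ * V c₃
    ≡⟨ cong₂ (λ x y → α * V c₁ + x + y) (ℤ.-1*i≡-i (V c₂)) (ℤ.-1*i≡-i (V c₃)) ⟩
  α * V c₁ - V c₂ - V c₃ ∎
  where
  open ≡-Reasoning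
  distrib : ∀ α x y z v → (α * x + -1ℤ * y + -1ℤ * z) * v ≡ α * (x * v) + -1ℤ * (y * v) + -1ℤ * (z * v)
  distrib = solve-∀
  pick : ∀ β c → c < N → ∑ℤ N (λ b → β * (δ c b * V b)) ≡ β * V c
  pick β c c<N = trans (∑ℤ-*ˡ N β _) (cong (β *_) (∑ℤ-δ N c V c<N))

≡ᵇ-refl : ∀ a → (a ≡ᵇ a) ≡ true
≡ᵇ-refl zero    = refl
≡ᵇ-refl (suc a) = ≡ᵇ-refl a

<⇒≡ᵇ-false : ∀ a b → a < b → (a ≡ᵇ b) ≡ false
<⇒≡ᵇ-false zero    (suc b) _         = refl
<⇒≡ᵇ-false (suc a) (suc b) (s≤s a<b) = <⇒≡ᵇ-false a b a<b

-- Rows 1, …, n-1 without the wrap-around edge: the second-difference stencil of a path.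
path-entry : ∀ a b →
  (if a ≡ᵇ b then + 2 else (if (b ≡ᵇ suc a) ∨ (a ≡ᵇ suc b) ∨ false ∨ false then -1ℤ else 0ℤ))
    ≡ + 2 * δ a b + -1ℤ * δ a (suc b) + -1ℤ * δ (suc a) b
path-entry zero          zero          = refl
path-entry zero          (suc zero)    = refl
path-entry zero          (suc (suc b)) = refl
path-entry (suc zero)    zero          = refl
path-entry (suc (suc a)) zero          = refl
path-entry (suc a)       (suc b)       = path-entry a b

wsum : ℕ → (ℕ → ℤ) → ℤ
wsum zero    f = 0ℤ
wsum (suc l) f = + suc l * f 0 + wsum l (f ∘ suc)

wsum-cong-< : ∀ l {f g : ℕ → ℤ} → (∀ i → i < l → f i ≡ g i) → wsum l f ≡ wsum l g
wsum-cong-< zero    f≡g = refl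
wsum-cong-< (suc l) f≡g =
  cong₂ _+_ (cong (+ suc l *_) (f≡g 0 (s≤s z≤n))) (wsum-cong-< l (λ i i<l → f≡g (suc i) (s≤s i<l)))

-- Plain and weighted sums of the second differences g of V over the indices t+1, …, m+2 telescope.
module Telescope (m : ℕ) (V g : ℕ → ℤ)
  (g-middle : ∀ t → t ≤ m → g (suc t) ≡ + 2 * V (suc t) - V t - V (2 ℕ.+ t)) where

  suffix-sums : ∀ l t → l ℕ.+ t ≡ suc m →
      ∑ℤ (suc l) (λ i → g (i ℕ.+ suc t)) ≡ g (2 ℕ.+ m) + V (suc m) - V (2 ℕ.+ m) - V t + V (suc t)
    × wsum (suc l) (λ i → g (i ℕ.+ suc t))
        ≡ g (2 ℕ.+ m) + V (suc m) - + 2 * V (2 ℕ.+ m) + V (suc t) - + suc l * (V t - V (suc t))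
  suffix-sums zero .(suc m) refl = base-sum (g (2 ℕ.+ m)) (V (suc m)) (V (2 ℕ.+ m))
                                 , base-wsum (g (2 ℕ.+ m)) (V (suc m)) (V (2 ℕ.+ m))
    where
    base-sum : ∀ G a b → G + 0ℤ ≡ G + a - b - a + b
    base-sum = solve-∀
    base-wsum : ∀ G a b → + 1 * G + 0ℤ ≡ G + a - + 2 * b + b - + 1 * (a - b)
    base-wsum = solve-∀
  suffix-sums (suc l) t l+t≡m =
      trans (cong₂ _+_ (g-middle t t≤m) (trans (∑ℤ-cong (suc l) shift-index) (proj₁ IH)))
            (step-sum (g (2 ℕ.+ m)) (V (suc m)) (V (2 ℕ.+ m)) (V t) (V (suc t)) (V (2 ℕ.+ t)))
    , trans (cong₂ _+_ (cong (+ suc (suc l) *_) (g-middle t t≤m))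
                       (trans (wsum-cong-< (suc l) (λ i _ → shift-index i)) (proj₂ IH)))
            (step-wsum (+ l) (g (2 ℕ.+ m)) (V (suc m)) (V (2 ℕ.+ m)) (V t) (V (suc t)) (V (2 ℕ.+ t)))
    where
    t≤m : t ≤ m
    t≤m = subst (t ≤_) (ℕ.suc-injective l+t≡m) (ℕ.m≤n+m t l)
    IH : ∑ℤ (suc l) (λ i → g (i ℕ.+ suc (suc t)))
           ≡ g (2 ℕ.+ m) + V (suc m) - V (2 ℕ.+ m) - V (suc t) + V (2 ℕ.+ t)
       × wsum (suc l) (λ i → g (i ℕ.+ suc (suc t)))
           ≡ g (2 ℕ.+ m) + V (suc m) - + 2 * V (2 ℕ.+ m) + V (2 ℕ.+ t) - + suc l * (V (suc t) - V (2 ℕ.+ t))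
    IH = suffix-sums l (suc t) (trans (ℕ.+-suc l t) l+t≡m)
    shift-index : ∀ i → g (suc i ℕ.+ suc t) ≡ g (i ℕ.+ suc (suc t))
    shift-index i = cong g (sym (ℕ.+-suc i (suc t)))
    step-sum : ∀ G a b x y z → (+ 2 * y - x - z) + (G + a - b - y + z) ≡ G + a - b - x + y
    step-sum = solve-∀
    step-wsum : ∀ L G a b x y z →
      (+ 1 + (+ 1 + L)) * (+ 2 * y - x - z) + (G + a - + 2 * b + z - (+ 1 + L) * (y - z))
        ≡ G + a - + 2 * b + y - (+ 1 + (+ 1 + L)) * (x - y)
    step-wsum = solve-∀

  tail-sums : ∑ℤ (2 ℕ.+ m) (g ∘ suc) ≡ g (2 ℕ.+ m) + V (suc m) - V (2 ℕ.+ m) - V 0 + V 1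
            × wsum (2 ℕ.+ m) (g ∘ suc)
                ≡ g (2 ℕ.+ m) + V (suc m) - + 2 * V (2 ℕ.+ m) + V 1 - + (2 ℕ.+ m) * (V 0 - V 1)
  tail-sums = trans (∑ℤ-cong (2 ℕ.+ m) i+1≡suc) (proj₁ sums)
            , trans (wsum-cong-< (2 ℕ.+ m) (λ i _ → i+1≡suc i)) (proj₂ sums)
    where
    sums : ∑ℤ (2 ℕ.+ m) (λ i → g (i ℕ.+ 1)) ≡ g (2 ℕ.+ m) + V (suc m) - V (2 ℕ.+ m) - V 0 + V 1
         × wsum (2 ℕ.+ m) (λ i → g (i ℕ.+ 1))
             ≡ g (2 ℕ.+ m) + V (suc m) - + 2 * V (2 ℕ.+ m) + V 1 - + (2 ℕ.+ m) * (V 0 - V 1)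
    sums = suffix-sums (suc m) 0 (ℕ.+-identityʳ (suc m))
    i+1≡suc : ∀ i → g (suc i) ≡ g (i ℕ.+ 1)
    i+1≡suc i = cong g (ℕ.+-comm 1 i)

module Rows (m : ℕ) (V : ℕ → ℤ) where

  Lmatℕ-first : ∀ b → Lmatℕ (3 ℕ.+ m) 0 b ≡ + 3 * δ 0 b + -1ℤ * δ 1 b + -1ℤ * δ (2 ℕ.+ m) b
  Lmatℕ-first zero          = refl
  Lmatℕ-first (suc zero)    = refl
  Lmatℕ-first (suc (suc b)) with b ≡ᵇ m
  ... | true  = refl
  ... | false = refl

  Lmatℕ-middle : ∀ a b → a ≤ m →
    Lmatℕ (3 ℕ.+ m) (suc a) b ≡ + 2 * δ (suc a) b + -1ℤ * δ a b + -1ℤ * δ (2 ℕ.+ a) b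
  Lmatℕ-middle zero    zero    _   = refl
  Lmatℕ-middle (suc a) zero    a≤m rewrite <⇒≡ᵇ-false a m a≤m = refl
  Lmatℕ-middle a       (suc b) _   = path-entry a b

  Lmatℕ-last : ∀ b → b < 3 ℕ.+ m →
    Lmatℕ (3 ℕ.+ m) (2 ℕ.+ m) b ≡ + 2 * δ (2 ℕ.+ m) b + -1ℤ * δ (suc m) b + -1ℤ * δ 0 b
  Lmatℕ-last zero    _         rewrite ≡ᵇ-refl m = refl
  Lmatℕ-last (suc b) (s≤s b<n) =
    trans (path-entry (suc m) b)
          (cong (λ t → + 2 * δ (suc m) b + -1ℤ * δ (suc m) (suc b) + -1ℤ * (if t then + 1 else 0ℤ))
                (<⇒≡ᵇ-false b (2 ℕ.+ m) b<n))

  Lrow-first : Lrow (3 ℕ.+ m) V 0 ≡ + 3 * V 0 - V 1 - V (2 ℕ.+ m)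
  Lrow-first =
    trans (∑ℤ-cong (3 ℕ.+ m) (λ b → cong (_* V b) (Lmatℕ-first b)))
          (∑ℤ-three-point (3 ℕ.+ m) (+ 3) 0 1 (2 ℕ.+ m) V (s≤s z≤n) (s≤s (s≤s z≤n)) ℕ.≤-refl)

  Lrow-middle : ∀ a → a ≤ m → Lrow (3 ℕ.+ m) V (suc a) ≡ + 2 * V (suc a) - V a - V (2 ℕ.+ a)
  Lrow-middle a a≤m =
    trans (∑ℤ-cong (3 ℕ.+ m) (λ b → cong (_* V b) (Lmatℕ-middle a b a≤m)))
          (∑ℤ-three-point (3 ℕ.+ m) (+ 2) (suc a) a (2 ℕ.+ a) V
             (s≤s (s≤s (ℕ.m≤n⇒m≤1+n a≤m)))
             (ℕ.m≤n⇒m≤1+n (s≤s (ℕ.m≤n⇒m≤1+n a≤m)))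
             (s≤s (s≤s (s≤s a≤m))))

  Lrow-last : Lrow (3 ℕ.+ m) V (2 ℕ.+ m) ≡ + 2 * V (2 ℕ.+ m) - V (suc m) - V 0
  Lrow-last =
    trans (∑ℤ-cong-< (3 ℕ.+ m) (λ b b<n → cong (_* V b) (Lmatℕ-last b b<n)))
          (∑ℤ-three-point (3 ℕ.+ m) (+ 2) (2 ℕ.+ m) (suc m) 0 V
             ℕ.≤-refl (s≤s (s≤s (ℕ.n≤1+n m))) (s≤s z≤n))

  private
    μ : ℕ → ℤ
    μ = Lrow (3 ℕ.+ m) V
    a b : ℤ
    a = V (suc m)
    b = V (2 ℕ.+ m)

  Lrow-sum : ∑ℤ (3 ℕ.+ m) μ ≡ V 0
  Lrow-sum = begin
    μ 0 + ∑ℤ (2 ℕ.+ m) (μ ∘ suc)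
      ≡⟨ cong (_+_ (μ 0)) (proj₁ tail-sums) ⟩
    μ 0 + (μ (2 ℕ.+ m) + a - b - V 0 + V 1)
      ≡⟨ cong₂ (λ x y → x + (y + a - b - V 0 + V 1)) Lrow-first Lrow-last ⟩
    (+ 3 * V 0 - V 1 - b) + ((+ 2 * b - a - V 0) + a - b - V 0 + V 1)
      ≡⟨ ring (V 0) (V 1) a b ⟩
    V 0 ∎
    where
    open ≡-Reasoning
    open Telescope m V μ Lrow-middle
    ring : ∀ v₀ v₁ a b → (+ 3 * v₀ - v₁ - b) + ((+ 2 * b - a - v₀) + a - b - v₀ + v₁) ≡ v₀
    ring = solve-∀

  Lrow-wsum : wsum (3 ℕ.+ m) μ ≡ + (3 ℕ.+ m) * (μ 0 + V 1 - V 0)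
  Lrow-wsum = begin
    + (3 ℕ.+ m) * μ 0 + wsum (2 ℕ.+ m) (μ ∘ suc)
      ≡⟨ cong (_+_ (+ (3 ℕ.+ m) * μ 0)) (proj₂ tail-sums) ⟩
    + (3 ℕ.+ m) * μ 0 + (μ (2 ℕ.+ m) + a - + 2 * b + V 1 - + (2 ℕ.+ m) * (V 0 - V 1))
      ≡⟨ cong (λ y → + (3 ℕ.+ m) * μ 0 + (y + a - + 2 * b + V 1 - + (2 ℕ.+ m) * (V 0 - V 1))) Lrow-last ⟩
    + (3 ℕ.+ m) * μ 0 + ((+ 2 * b - a - V 0) + a - + 2 * b + V 1 - + (2 ℕ.+ m) * (V 0 - V 1))
      ≡⟨ ring (+ m) (μ 0) (V 0) (V 1) a b ⟩
    + (3 ℕ.+ m) * (μ 0 + V 1 - V 0) ∎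
    where
    open ≡-Reasoning
    open Telescope m V μ Lrow-middle
    ring : ∀ M μ₀ v₀ v₁ a b →
      (+ 1 + (+ 1 + (+ 1 + M))) * μ₀ + ((+ 2 * b - a - v₀) + a - + 2 * b + v₁ - (+ 1 + (+ 1 + M)) * (v₀ - v₁))
        ≡ (+ 1 + (+ 1 + (+ 1 + M))) * (μ₀ + v₁ - v₀)
    ring = solve-∀

-- Solving L_n λ = μ

-- The middle row equations of L_n λ = μ, read forwards as λ_{t+2} = 2λ_{t+1} - λ_t - μ_{t+1}.
unfold : ℤ → ℤ → (ℕ → ℤ) → ℕ → ℤ
unfold x₀ x₁ M zero          = x₀
unfold x₀ x₁ M (suc zero)    = x₁
unfold x₀ x₁ M (suc (suc t)) = + 2 * unfold x₀ x₁ M (suc t) - unfold x₀ x₁ M t - M (suc t)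

solve-middle : ∀ a b c → c ≡ + 2 * b - a - (+ 2 * b - a - c)
solve-middle = solve-∀

unfold-middle : ∀ x₀ x₁ M t →
  M (suc t) ≡ + 2 * unfold x₀ x₁ M (suc t) - unfold x₀ x₁ M t - unfold x₀ x₁ M (2 ℕ.+ t)
unfold-middle x₀ x₁ M t = solve-middle (unfold x₀ x₁ M t) (unfold x₀ x₁ M (suc t)) (M (suc t))

unfold-unique : ∀ m x₀ x₁ M (V : ℕ → ℤ) → V 0 ≡ x₀ → V 1 ≡ x₁ →
  (∀ t → t ≤ m → M (suc t) ≡ + 2 * V (suc t) - V t - V (2 ℕ.+ t)) →
  ∀ j → j ≤ 2 ℕ.+ m → unfold x₀ x₁ M j ≡ V j
unfold-unique m x₀ x₁ M V V₀ V₁ V-middle zero    _            = sym V₀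
unfold-unique m x₀ x₁ M V V₀ V₁ V-middle (suc j) (s≤s j≤m+1) = proj₂ (consecutive j j≤m+1)
  where
  consecutive : ∀ j → j ≤ suc m → unfold x₀ x₁ M j ≡ V j × unfold x₀ x₁ M (suc j) ≡ V (suc j)
  consecutive zero    _         = sym V₀ , sym V₁
  consecutive (suc j) (s≤s j≤m) = proj₂ IH , (begin
    + 2 * unfold x₀ x₁ M (suc j) - unfold x₀ x₁ M j - M (suc j)
      ≡⟨ cong₂ (λ x y → + 2 * x - y - M (suc j)) (proj₂ IH) (proj₁ IH) ⟩
    + 2 * V (suc j) - V j - M (suc j)
      ≡⟨ cong (λ x → + 2 * V (suc j) - V j - x) (V-middle j j≤m) ⟩
    + 2 * V (suc j) - V j - (+ 2 * V (suc j) - V j - V (2 ℕ.+ j))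
      ≡⟨ solve-middle (V j) (V (suc j)) (V (2 ℕ.+ j)) ⟨
    V (2 ℕ.+ j) ∎)
    where
    open ≡-Reasoning
    IH : unfold x₀ x₁ M j ≡ V j × unfold x₀ x₁ M (suc j) ≡ V (suc j)
    IH = consecutive j (ℕ.m≤n⇒m≤1+n j≤m)

-- λ is recovered from μ = L_n λ: λ₀ = Σ μ and λ₁ - λ₀ = wsum μ / n - μ₀ by the two row identities.
Lrow-injective : ∀ m (V V′ : ℕ → ℤ) → (∀ a → a < 3 ℕ.+ m → Lrow (3 ℕ.+ m) V a ≡ Lrow (3 ℕ.+ m) V′ a) →
                 ∀ j → j < 3 ℕ.+ m → V j ≡ V′ j
Lrow-injective m V V′ L≡ j (s≤s j≤) =
  trans (sym (unfold-unique m (V 0) (V 1) μ V refl refl R.Lrow-middle j j≤))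
        (unfold-unique m (V 0) (V 1) μ V′ (sym V₀≡) (sym V₁≡) middle′ j j≤)
  where
  open ≡-Reasoning
  module R = Rows m V
  module R′ = Rows m V′
  μ μ′ : ℕ → ℤ
  μ = Lrow (3 ℕ.+ m) V
  μ′ = Lrow (3 ℕ.+ m) V′
  V₀≡ : V 0 ≡ V′ 0
  V₀≡ = trans (sym R.Lrow-sum) (trans (∑ℤ-cong-< (3 ℕ.+ m) L≡) R′.Lrow-sum)
  weights : μ 0 + V 1 - V 0 ≡ μ′ 0 + V′ 1 - V′ 0
  weights = ℤ.*-cancelˡ-≡ (+ (3 ℕ.+ m)) _ _
              (trans (sym R.Lrow-wsum) (trans (wsum-cong-< (3 ℕ.+ m) L≡) R′.Lrow-wsum))
  recover : ∀ μ₀ v₀ v₁ → v₁ ≡ μ₀ + v₁ - v₀ - μ₀ + v₀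
  recover = solve-∀
  V₁≡ : V 1 ≡ V′ 1
  V₁≡ = begin
    V 1                              ≡⟨ recover (μ 0) (V 0) (V 1) ⟩
    μ 0 + V 1 - V 0 - μ 0 + V 0        ≡⟨ cong₂ (λ w x → w - x + V 0) weights (L≡ 0 (s≤s z≤n)) ⟩
    μ′ 0 + V′ 1 - V′ 0 - μ′ 0 + V 0    ≡⟨ cong (_+_ (μ′ 0 + V′ 1 - V′ 0 - μ′ 0)) V₀≡ ⟩
    μ′ 0 + V′ 1 - V′ 0 - μ′ 0 + V′ 0   ≡⟨ recover (μ′ 0) (V′ 0) (V′ 1) ⟨
    V′ 1                             ∎
  middle′ : ∀ t → t ≤ m → μ (suc t) ≡ + 2 * V′ (suc t) - V′ t - V′ (2 ℕ.+ t)
  middle′ t t≤m = trans (L≡ (suc t) (s≤s (s≤s (ℕ.m≤n⇒m≤1+n t≤m)))) (R′.Lrow-middle t t≤m)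

-- Once the middle rows are known, Σ μ = K and wsum μ = (1 + c) Q pin down the first and the last row.
end-rows : ∀ (c M₀ Mₗ a b K Q : ℤ) →
  M₀ + (Mₗ + a - b - K + (K + (Q - M₀))) ≡ K →
  (+ 1 + c) * M₀ + (Mₗ + a - + 2 * b + (K + (Q - M₀)) - c * (K - (K + (Q - M₀)))) ≡ (+ 1 + c) * Q →
  + 3 * K - (K + (Q - M₀)) - b ≡ M₀ × + 2 * b - a - K ≡ Mₗ
end-rows c M₀ Mₗ a b K Q S≡K W≡nQ = first , last
  where
  open ≡-Reasoning
  last : + 2 * b - a - K ≡ Mₗ
  last = begin
    + 2 * b - a - K
      ≡⟨ ring₁ c M₀ Mₗ a b K Q ⟩
    Mₗ - ((+ 1 + c) * M₀ + (Mₗ + a - + 2 * b + (K + (Q - M₀)) - c * (K - (K + (Q - M₀)))) - (+ 1 + c) * Q)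
      ≡⟨ cong (λ w → Mₗ - (w - (+ 1 + c) * Q)) W≡nQ ⟩
    Mₗ - ((+ 1 + c) * Q - (+ 1 + c) * Q)
      ≡⟨ ring₂ Mₗ ((+ 1 + c) * Q) ⟩
    Mₗ ∎
    where
    ring₁ : ∀ c M₀ Mₗ a b K Q → + 2 * b - a - K
          ≡ Mₗ - ((+ 1 + c) * M₀ + (Mₗ + a - + 2 * b + (K + (Q - M₀)) - c * (K - (K + (Q - M₀)))) - (+ 1 + c) * Q)
    ring₁ = solve-∀
    ring₂ : ∀ x y → x - (y - y) ≡ x
    ring₂ = solve-∀
  first : + 3 * K - (K + (Q - M₀)) - b ≡ M₀
  first = begin
    + 3 * K - (K + (Q - M₀)) - b
      ≡⟨ ring₁ M₀ Mₗ a b K Q ⟩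
    M₀ - (M₀ + (Mₗ + a - b - K + (K + (Q - M₀))) - K) + (Mₗ - (+ 2 * b - a - K))
      ≡⟨ cong₂ (λ s l → M₀ - (s - K) + (Mₗ - l)) S≡K last ⟩
    M₀ - (K - K) + (Mₗ - Mₗ)
      ≡⟨ ring₂ M₀ K Mₗ ⟩
    M₀ ∎
    where
    ring₁ : ∀ M₀ Mₗ a b K Q → + 3 * K - (K + (Q - M₀)) - b
          ≡ M₀ - (M₀ + (Mₗ + a - b - K + (K + (Q - M₀))) - K) + (Mₗ - (+ 2 * b - a - K))
    ring₁ = solve-∀
    ring₂ : ∀ x y z → x - (y - y) + (z - z) ≡ x
    ring₂ = solve-∀

Lrow-unfold : ∀ m (M : ℕ → ℤ) Q → wsum (3 ℕ.+ m) M ≡ + (3 ℕ.+ m) * Q →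
  ∀ a → a < 3 ℕ.+ m → Lrow (3 ℕ.+ m) (unfold (∑ℤ (3 ℕ.+ m) M) (∑ℤ (3 ℕ.+ m) M + (Q - M 0)) M) a ≡ M a
Lrow-unfold m M Q wsum≡nQ = rows
  where
  K : ℤ
  K = ∑ℤ (3 ℕ.+ m) M
  V : ℕ → ℤ
  V = unfold K (K + (Q - M 0)) M
  open Rows m V
  open Telescope m V M (λ t _ → unfold-middle K (K + (Q - M 0)) M t)
  ends : + 3 * K - (K + (Q - M 0)) - V (2 ℕ.+ m) ≡ M 0 × + 2 * V (2 ℕ.+ m) - V (suc m) - K ≡ M (2 ℕ.+ m)
  ends = end-rows (+ (2 ℕ.+ m)) (M 0) (M (2 ℕ.+ m)) (V (suc m)) (V (2 ℕ.+ m)) K Q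
           (sym (cong (_+_ (M 0)) (proj₁ tail-sums)))
           (trans (cong (_+_ (+ (3 ℕ.+ m) * M 0)) (sym (proj₂ tail-sums))) wsum≡nQ)
  rows : ∀ a → a < 3 ℕ.+ m → Lrow (3 ℕ.+ m) V a ≡ M a
  rows zero    _             = trans Lrow-first (proj₁ ends)
  rows (suc a) (s≤s (s≤s a≤m+1)) with ℕ.m≤n⇒m<n∨m≡n a≤m+1
  ... | inj₁ (s≤s a≤m) = trans (Lrow-middle a a≤m) (sym (unfold-middle K (K + (Q - M 0)) M a))
  ... | inj₂ refl      = trans Lrow-last (proj₂ ends)

-- Lattice points of the cone

lookupℕ : {A : Set} {k : ℕ} → A → Vec A k → ℕ → A
lookupℕ d []       _       = d
lookupℕ d (x ∷ xs) zero    = x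
lookupℕ d (x ∷ xs) (suc a) = lookupℕ d xs a

module _ {A : Set} (d : A) where

  lookup≡lookupℕ : ∀ {k} (v : Vec A k) i → Vec.lookup v i ≡ lookupℕ d v (toℕ i)
  lookup≡lookupℕ (x ∷ v) Fin.zero    = refl
  lookup≡lookupℕ (x ∷ v) (Fin.suc i) = lookup≡lookupℕ v i

  lookupℕ-tabulate : ∀ {k} (f : Fin k → A) a (a<k : a < k) → lookupℕ d (Vec.tabulate f) a ≡ f (Fin.fromℕ< a<k)
  lookupℕ-tabulate {suc k} f zero    _         = refl
  lookupℕ-tabulate {suc k} f (suc a) (s≤s a<k) = lookupℕ-tabulate (f ∘ Fin.suc) a a<k

  lookupℕ-injective : ∀ {k} (v v′ : Vec A k) → (∀ j → j < k → lookupℕ d v j ≡ lookupℕ d v′ j) → v ≡ v′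
  lookupℕ-injective []      []        _   = refl
  lookupℕ-injective (x ∷ v) (x′ ∷ v′) v≡v′ =
    cong₂ _∷_ (v≡v′ 0 (s≤s z≤n)) (lookupℕ-injective v v′ (λ j j<k → v≡v′ (suc j) (s≤s j<k)))

∀Fin⇒∀< : ∀ {k} {P : ℕ → Set} → (∀ (i : Fin k) → P (toℕ i)) → ∀ a → a < k → P a
∀Fin⇒∀< {P = P} P-Fin a a<k = subst P (Fin.toℕ-fromℕ< a<k) (P-Fin (Fin.fromℕ< a<k))

sumFin≡∑ℤ : ∀ k (h : ℕ → ℤ) → sumFin k (h ∘ toℕ) ≡ ∑ℤ k h
sumFin≡∑ℤ k h = trans (cong (List.foldr _+_ 0ℤ) (List.map-tabulate {n = k} id (h ∘ toℕ))) (foldr-tabulate k h)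
  where
  foldr-tabulate : ∀ k (h : ℕ → ℤ) → List.foldr _+_ 0ℤ (List.tabulate {n = k} (h ∘ toℕ)) ≡ ∑ℤ k h
  foldr-tabulate zero    h = refl
  foldr-tabulate (suc k) h = cong (_+_ (h 0)) (foldr-tabulate k (h ∘ suc))

Lapply≡Lrow : ∀ n (v : Vec ℤ n) i → Lapply n v i ≡ Lrow n (lookupℕ 0ℤ v) (toℕ i)
Lapply≡Lrow n v i =
  trans (cong (List.foldr _+_ 0ℤ) (List.map-cong (λ j → cong (Lmat n i j *_) (lookup≡lookupℕ 0ℤ v j)) (allFin n)))
        (sumFin≡∑ℤ n (λ b → Lmatℕ n (toℕ i) b * lookupℕ 0ℤ v b))

Lrow-cong-< : ∀ n {V V′ : ℕ → ℤ} → (∀ b → b < n → V b ≡ V′ b) → ∀ a → Lrow n V a ≡ Lrow n V′ a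
Lrow-cong-< n V≡V′ a = ∑ℤ-cong-< n (λ b b<n → cong (Lmatℕ n a b *_) (V≡V′ b b<n))

+sum≡∑ℤ : ∀ {k} (μ : Vec ℕ k) → + Vec.sum μ ≡ ∑ℤ k (+_ ∘ lookupℕ 0 μ)
+sum≡∑ℤ []      = refl
+sum≡∑ℤ (x ∷ μ) = trans (ℤ.pos-+ x (Vec.sum μ)) (cong (_+_ (+ x)) (+sum≡∑ℤ μ))

+wt≡wsum : ∀ {k} (μ : Vec ℕ k) → + wt μ ≡ wsum k (+_ ∘ lookupℕ 0 μ)
+wt≡wsum []              = refl
+wt≡wsum {suc k} (x ∷ μ) = trans (ℤ.pos-+ (suc k ℕ.* x) (wt μ)) (cong₂ _+_ (ℤ.pos-* (suc k) x) (+wt≡wsum μ))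

module LatticePoints (m : ℕ) where

  n : ℕ
  n = 3 ℕ.+ m

  open Counting (2 ℕ.+ m) using (compCount; residueCount; divides?; compCount-gf; numCoeff≡residueCount)

  rowsOf : Vec ℤ n → Vec ℕ n
  rowsOf v = Vec.tabulate (λ i → ∣ Lapply n v i ∣)

  solve : Vec ℕ n → Vec ℤ n
  solve μ = Vec.tabulate (λ i → unfold K (K + (+ (wt μ / n) - M 0)) M (toℕ i))
    where
    M : ℕ → ℤ
    M = +_ ∘ lookupℕ 0 μ
    K : ℤ
    K = ∑ℤ n M

  coord0-solve : ∀ μ → coord0 (solve μ) ≡ + Vec.sum μ
  coord0-solve μ = sym (+sum≡∑ℤ μ)

  coord0-nonneg : (v : Vec ℤ n) → InCone n v → 0ℤ ℤ.≤ coord0 v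
  coord0-nonneg v@(_ ∷ _) cone = subst (0ℤ ℤ.≤_) (Rows.Lrow-sum m (lookupℕ 0ℤ v))
    (∑ℤ-nonneg n (Lrow n (lookupℕ 0ℤ v)) (∀Fin⇒∀< (λ i → subst (0ℤ ℤ.≤_) (Lapply≡Lrow n v i) (cone i))))

  module _ (μ : Vec ℕ n) (n∣wt : n ∣ wt μ) where

    Lapply-solve : ∀ i → Lapply n (solve μ) i ≡ + Vec.lookup μ i
    Lapply-solve i = begin
      Lapply n (solve μ) i                    ≡⟨ Lapply≡Lrow n (solve μ) i ⟩
      Lrow n (lookupℕ 0ℤ (solve μ)) (toℕ i)   ≡⟨ Lrow-cong-< n lookup-solve (toℕ i) ⟩
      Lrow n V (toℕ i)                        ≡⟨ Lrow-unfold m M Q wsum≡nQ (toℕ i) (Fin.toℕ<n i) ⟩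
      + lookupℕ 0 μ (toℕ i)                   ≡⟨ cong +_ (lookup≡lookupℕ 0 μ i) ⟨
      + Vec.lookup μ i                        ∎
      where
      open ≡-Reasoning
      M : ℕ → ℤ
      M = +_ ∘ lookupℕ 0 μ
      Q : ℤ
      Q = + (wt μ / n)
      V : ℕ → ℤ
      V = unfold (∑ℤ n M) (∑ℤ n M + (Q - M 0)) M
      lookup-solve : ∀ b → b < n → lookupℕ 0ℤ (solve μ) b ≡ V b
      lookup-solve b b<n = trans (lookupℕ-tabulate 0ℤ (V ∘ toℕ) b b<n) (cong V (Fin.toℕ-fromℕ< b<n))
      wsum≡nQ : wsum n M ≡ + n * Q
      wsum≡nQ = begin
        wsum n M            ≡⟨ +wt≡wsum μ ⟨
        + wt μ              ≡⟨ cong +_ (m/n*n≡m n∣wt) ⟨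
        + (wt μ / n ℕ.* n)  ≡⟨ ℤ.pos-* (wt μ / n) n ⟩
        Q * + n             ≡⟨ ℤ.*-comm Q (+ n) ⟩
        + n * Q             ∎

    solve-cone : InCone n (solve μ)
    solve-cone i = subst (0ℤ ℤ.≤_) (sym (Lapply-solve i)) (ℤ.+≤+ z≤n)

    rowsOf-solve : rowsOf (solve μ) ≡ μ
    rowsOf-solve = trans (Vec.tabulate-cong (λ i → cong ∣_∣ (Lapply-solve i))) (Vec.tabulate∘lookup μ)

  module _ (v : Vec ℤ n) (cone : InCone n v) where

    rowsOf≡Lrow : ∀ a → a < n → + lookupℕ 0 (rowsOf v) a ≡ Lrow n (lookupℕ 0ℤ v) a
    rowsOf≡Lrow = ∀Fin⇒∀< λ i → begin
      + lookupℕ 0 (rowsOf v) (toℕ i)  ≡⟨ cong +_ (lookup≡lookupℕ 0 (rowsOf v) i) ⟨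
      + Vec.lookup (rowsOf v) i       ≡⟨ cong +_ (Vec.lookup∘tabulate (λ i → ∣ Lapply n v i ∣) i) ⟩
      + ∣ Lapply n v i ∣               ≡⟨ ℤ.0≤i⇒+∣i∣≡i (cone i) ⟩
      Lapply n v i                    ≡⟨ Lapply≡Lrow n v i ⟩
      Lrow n (lookupℕ 0ℤ v) (toℕ i)   ∎
      where open ≡-Reasoning

    sum-rowsOf : + Vec.sum (rowsOf v) ≡ lookupℕ 0ℤ v 0
    sum-rowsOf = trans (+sum≡∑ℤ (rowsOf v)) (trans (∑ℤ-cong-< n rowsOf≡Lrow) (Rows.Lrow-sum m (lookupℕ 0ℤ v)))

    n∣wt-rowsOf : n ∣ wt (rowsOf v)
    n∣wt-rowsOf = divides ∣ X ∣ (begin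
      wt (rowsOf v)         ≡⟨ cong ∣_∣ +wt≡nX ⟩
      ∣ + n * X ∣            ≡⟨ ℤ.abs-* (+ n) X ⟩
      n ℕ.* ∣ X ∣            ≡⟨ ℕ.*-comm n ∣ X ∣ ⟩
      ∣ X ∣ ℕ.* n            ∎)
      where
      open ≡-Reasoning
      V : ℕ → ℤ
      V = lookupℕ 0ℤ v
      X : ℤ
      X = Lrow n V 0 + V 1 - V 0
      +wt≡nX : + wt (rowsOf v) ≡ + n * X
      +wt≡nX = trans (+wt≡wsum (rowsOf v)) (trans (wsum-cong-< n rowsOf≡Lrow) (Rows.Lrow-wsum m V))

    solve-rowsOf : solve (rowsOf v) ≡ v
    solve-rowsOf = lookupℕ-injective 0ℤ (solve (rowsOf v)) v
      (Lrow-injective m _ _ (∀Fin⇒∀< λ i → begin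
        Lrow n (lookupℕ 0ℤ (solve (rowsOf v))) (toℕ i)  ≡⟨ Lapply≡Lrow n (solve (rowsOf v)) i ⟨
        Lapply n (solve (rowsOf v)) i                   ≡⟨ Lapply-solve (rowsOf v) n∣wt-rowsOf i ⟩
        + Vec.lookup (rowsOf v) i                       ≡⟨ cong +_ (lookup≡lookupℕ 0 (rowsOf v) i) ⟩
        + lookupℕ 0 (rowsOf v) (toℕ i)                  ≡⟨ rowsOf≡Lrow (toℕ i) (Fin.toℕ<n i) ⟩
        Lrow n (lookupℕ 0ℤ v) (toℕ i)                   ∎))
      where open ≡-Reasoning

  cone-card : ∀ k → HasCard (λ (v : Vec ℤ n) → InCone n v × coord0 v ≡ + k) (compCount n 0 k)
  cone-card k = List.map solve μs , unique , (λ v → mk⇔ (to v) (from v)) , List.length-map solve μs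
    where
    μs : List (Vec ℕ n)
    μs = filter (divides? 0) (compositions n k)
    rowsOf∘solve : List.map rowsOf (List.map solve μs) ≡ μs
    rowsOf∘solve = trans (sym (List.map-∘ μs))
                         (List.map-id-local (All.map (λ {μ} → rowsOf-solve μ) (all-filter (divides? 0) (compositions n k))))
    unique : Unique (List.map solve μs)
    unique = Unique.map⁻ (subst Unique (sym rowsOf∘solve) (Unique.filter⁺ (divides? 0) (compositions-unique n k)))
    to : ∀ v → v ∈ List.map solve μs → InCone n v × coord0 v ≡ + k
    to v v∈ with ∈-map⁻ solve v∈
    ... | μ , μ∈ , refl with ∈-filter⁻ (divides? 0) {xs = compositions n k} μ∈
    ...   | μ∈comp , n∣wt = solve-cone μ n∣wt , trans (coord0-solve μ) (cong +_ (∈-compositions⁻ n k μ μ∈comp))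
    from : ∀ v → InCone n v × coord0 v ≡ + k → v ∈ List.map solve μs
    from v@(_ ∷ _) (cone , v₀≡k) = subst (_∈ List.map solve μs) (solve-rowsOf v cone)
      (∈-map⁺ solve (∈-filter⁺ (divides? 0)
        (∈-compositions⁺ n k (rowsOf v) (ℤ.+-injective (trans (sum-rowsOf v cone) v₀≡k)))
        (n∣wt-rowsOf v cone)))

  cone-gf : ∀ k → (toℤSeries (compCount n 0) ⊛ (oneMinusQ^ n ^ˢ n)) k ≡ + numCoeff n k
  cone-gf k = begin
    (toℤSeries (compCount n 0) ⊛ (oneMinusQ^ n ^ˢ n)) k  ≡⟨ ⊛≗conv (toℤSeries (compCount n 0)) (oneMinusQ^ n ^ˢ n) k ⟩
    conv (toℤSeries (compCount n 0)) (oneMinusQ^ n ^ˢ n) k ≡⟨ compCount-gf n 0 k ⟩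
    + residueCount n 0 k                                  ≡⟨ cong +_ (numCoeff≡residueCount k) ⟨
    + numCoeff n k                                        ∎
    where open ≡-Reasoning

theorem5p1 : (n : ℕ) → 3 ≤ n →
    Σ (ℕ → ℕ) λ a →
      ((v : Vec ℤ n) → InCone n v → + 0 Data.Integer.≤ coord0 v)
      × ((k : ℕ) → HasCard (λ (v : Vec ℤ n) → InCone n v × coord0 v ≡ + k) (a k))
      × ((k : ℕ) → (toℤSeries a ⊛ (oneMinusQ^ n ^ˢ n)) k ≡ + (numCoeff n k))
theorem5p1 (suc (suc (suc m))) (s≤s (s≤s (s≤s z≤n))) =
  Counting.compCount (2 ℕ.+ m) n 0 , coord0-nonneg , cone-card , cone-gf
  where open LatticePoints m
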